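{- Let $\alpha\in(0,1)$ and let $\gamma,\beta$ be positive constants with $8\gamma<\beta<\frac15(1-\alpha)$. Let $G$ be an $n$-vertex graph with $\delta(G)\geq \alpha n$. Then one of the following holds. (a) There is a partition $V(G)=A_1\cup A_2$ (disjoint) with $|A_1| = (1-\alpha\pm\gamma)n$ such that: (i) for every $x\in A_1$, $|A_2\setminus N_G(x)|\leq 4\beta n$; (ii) for every $x\in A_2$, $|N_G(x)\cap A_1|\geq \beta n$; (iii) there are at most $\gamma n^2$ pairs $\{a_1,a_2\}$ with $a_1\in A_1$, $a_2\in A_2$ that are not edges of $G$. (b) Every $X\subseteq V(G)$ with $|X| = (1-\alpha)n$ satisfies $e_G(X)\geq \gamma^2 n^2$.
   Context: $N_G(x)$ is the neighbourhood of $x$ in $G$; $e_G(X)$ is the number of edges of $G$ with both endpoints in $X$; $|A_1|=(1-\alpha\pm\gamma)n$ means $(1-\alpha-\gamma)n\leq |A_1|\leq (1-\alpha+\gamma)n$.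
   Formalization: The constants α, γ and β range over the rationals. -}

module Defs where

open import Data.Bool using (Bool; true; false; if_then_else_; T)
open import Data.Nat using (ℕ; _<ᵇ_)
open import Data.Fin using (Fin; toℕ)
open import Data.Fin.Subset using (Subset; _∩_; ∁; ∣_∣)
open import Data.List using (map; allFin)
open import Data.Nat.ListAction using (sum)
open import Data.Vec using (lookup; tabulate)
open import Data.Integer using (+_)
open import Data.Rational using (ℚ; _/_)
open import Relation.Binary.PropositionalEquality using (_≡_)
open import Relation.Nullary using (¬_)

record Graph (n : ℕ) : Set where
  field
    adj   : Fin n → Fin n → Bool
    sym   : ∀ x y → adj x y ≡ adj y x
    irrefl : ∀ x → adj x x ≡ false
open Graph public

⟦_⟧ : ℕ → ℚ
⟦ k ⟧ = + k / 1

N : ∀ {n} → Graph n → Fin n → Subset n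
N G x = tabulate (adj G x)

Σv : ∀ {n} → (Fin n → ℕ) → ℕ
Σv {n} f = sum (map f (allFin n))

-- number of pairs {a₁,a₂}, a₁ ∈ A, a₂ ∈ B, which are not edges
-- (for disjoint A, B each such unordered pair is counted exactly once)
nonEdgesBetween : ∀ {n} → Graph n → Subset n → Subset n → ℕ
nonEdgesBetween G A B = Σv (λ x → if lookup A x then ∣ B ∩ ∁ (N G x) ∣ else 0)

-- e_G(X): number of edges with both endpoints in X
-- (each edge {x,y} with x < y counted once, at its smaller endpoint x)
edgesIn : ∀ {n} → Graph n → Subset n → ℕ
edgesIn G X = Σv (λ x → if lookup X x
                          then ∣ X ∩ (N G x ∩ tabulate (λ y → toℕ x <ᵇ toℕ y)) ∣
                          else 0)

-- Fix X with |X| = (1-α)n and e(X) < γ²n², and write b = βn, g = γn. Let B be the vertices of X with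
-- more than 3b neighbours in X, C the vertices outside X with fewer than b neighbours in X ∖ B, and
-- A₁ = (X ∖ B) ∪ C. Since Σ_{x∈X} d_X(x) = 2e(X) < 2g² and 8g ≤ b, Markov's inequality gives |B| < g/12.
-- The minimum degree makes every x ∈ X miss at most d_X(x) vertices outside X, so fewer than 2g² pairs
-- of X × (V ∖ X) are non-edges, while every vertex of C misses at least |X| - |B| - b ≥ 3b vertices of X;
-- hence |C| < g/12 too. Now |A₁| = |X| - |B| + |C|, and (i)-(iii) follow by comparing neighbourhoods in
-- A₁ with those in X, up to the few vertices of B and C. Which of (a) and (b) applies is decided by
-- searching through all subsets X.
module Submission where

open import Defs using (Graph; adj; ⟦_⟧; N; Σv; nonEdgesBetween; edgesIn)
open import Data.Bool using (Bool; true; false; not; _∧_; _∨_; if_then_else_; T)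
open import Data.Bool.Properties using (T-∧; T-∨; T-≡; T-not-≡; ∧-zeroʳ)
open import Data.Fin using (Fin; zero; suc; toℕ)
import Data.Fin.Properties as FinP
open import Data.Fin.Subset using (Subset; _∈_; _∩_; ∁; ∣_∣)
open import Data.Fin.Subset.Properties using (anySubset?)
import Data.List as List
import Data.List.Properties as ListP
open import Data.Nat as ℕ using (ℕ; zero; suc)
import Data.Nat.Coprimality as Coprime
open import Data.Nat.ListAction using () renaming (sum to sumˡ)
import Data.Nat.Properties as ℕP
import Data.Nat.Solver as ℕ-Solver
open import Data.Product using (Σ; _×_; _,_; proj₁; proj₂)
open import Data.Sum using (_⊎_; inj₁; inj₂)
open import Data.Vec using (Vec; []; _∷_; lookup; tabulate)
open import Data.Vec.Properties using ([]=⇒lookup; lookup-map; lookup-zipWith; lookup∘tabulate)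
open import Function using (_∘_; case_of_; Equivalence)
open import Relation.Binary.Definitions using (tri<; tri≈; tri>)
open import Relation.Binary.PropositionalEquality
open import Relation.Nullary using (¬_; Dec; yes; no; ¬?; _×-dec_)
open import Relation.Nullary.Decidable using (isYes; toWitness; toWitnessFalse; decidable-stable)

open import Algebra.Properties.CommutativeMonoid.Sum ℕP.+-0-commutativeMonoid
  using (sum; ∑-distrib-+; ∑-comm; sum-cong-≗)

module Counting where

  open import Data.Nat using (_+_; _*_; _≤_; _≤ᵇ_; _≡ᵇ_)

  χ : Bool → ℕ
  χ true  = 1
  χ false = 0

  # : ∀ {n} → (Fin n → Bool) → ℕ
  # P = sum (χ ∘ P)

  #² : ∀ {n} → (Fin n → Fin n → Bool) → ℕ
  #² R = sum (λ x → # (R x))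

  sum-mono-≤ : ∀ {n} {f g : Fin n → ℕ} → (∀ i → f i ≤ g i) → sum f ≤ sum g
  sum-mono-≤ {zero}  _   = ℕ.z≤n
  sum-mono-≤ {suc n} f≤g = ℕP.+-mono-≤ (f≤g zero) (sum-mono-≤ (f≤g ∘ suc))

  sum-const : ∀ n c → sum {n} (λ _ → c) ≡ n * c
  sum-const zero    c = refl
  sum-const (suc n) c = cong (c +_) (sum-const n c)

  #-+-≡ : ∀ {n} {P Q R S : Fin n → Bool} → (∀ i → χ (P i) + χ (Q i) ≡ χ (R i) + χ (S i)) →
          # P + # Q ≡ # R + # S
  #-+-≡ {P = P} {Q} {R} {S} h =
    trans (sym (∑-distrib-+ (χ ∘ P) (χ ∘ Q))) (trans (sum-cong-≗ h) (∑-distrib-+ (χ ∘ R) (χ ∘ S)))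

  #-≤-+ : ∀ {n} {P Q R : Fin n → Bool} → (∀ i → χ (P i) ≤ χ (Q i) + χ (R i)) → # P ≤ # Q + # R
  #-≤-+ {Q = Q} {R} h = ℕP.≤-trans (sum-mono-≤ h) (ℕP.≤-reflexive (∑-distrib-+ (χ ∘ Q) (χ ∘ R)))

  #-complement : ∀ {n} (P : Fin n → Bool) → # (not ∘ P) + # P ≡ n
  #-complement {n} P = begin
    # (not ∘ P) + # P      ≡⟨ ∑-distrib-+ (χ ∘ not ∘ P) (χ ∘ P) ⟨
    sum (λ i → χ (not (P i)) + χ (P i)) ≡⟨ sum-cong-≗ (λ i → χ-not+χ (P i)) ⟩
    sum {n} (λ _ → 1)      ≡⟨ sum-const n 1 ⟩
    n * 1                  ≡⟨ ℕP.*-identityʳ n ⟩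
    n                      ∎
    where
    open ≡-Reasoning
    χ-not+χ : ∀ b → χ (not b) + χ b ≡ 1
    χ-not+χ true  = refl
    χ-not+χ false = refl

  #≤n : ∀ {n} (P : Fin n → Bool) → # P ≤ n
  #≤n {n} P = subst (# P ≤_) (#-complement P) (ℕP.m≤n+m (# P) (# (not ∘ P)))

  sumˡ-tabulate : ∀ {n} (f : Fin n → ℕ) → sumˡ (List.tabulate f) ≡ sum f
  sumˡ-tabulate {zero}  f = refl
  sumˡ-tabulate {suc n} f = cong (f zero +_) (sumˡ-tabulate (f ∘ suc))

  Σv≡sum : ∀ {n} (f : Fin n → ℕ) → Σv f ≡ sum f
  Σv≡sum f = trans (cong sumˡ (ListP.map-tabulate (λ i → i) f)) (sumˡ-tabulate f)

  ∣∣≡# : ∀ {n} (A : Subset n) → ∣ A ∣ ≡ # (lookup A)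
  ∣∣≡# []          = refl
  ∣∣≡# (true ∷ A)  = cong suc (∣∣≡# A)
  ∣∣≡# (false ∷ A) = ∣∣≡# A

  ∣∣≡#-cong : ∀ {n} (A : Subset n) {P : Fin n → Bool} → (∀ i → lookup A i ≡ P i) → ∣ A ∣ ≡ # P
  ∣∣≡#-cong A A≗P = trans (∣∣≡# A) (sum-cong-≗ (cong χ ∘ A≗P))

  if-# : ∀ {n} b (P : Fin n → Bool) → (if b then # P else 0) ≡ # (λ i → b ∧ P i)
  if-# true  P = refl
  if-# {n} false P = sym (trans (sum-const n 0) (ℕP.*-zeroʳ n))

  allAssignments : ∀ k → (Vec Bool k → Bool) → Bool
  allAssignments zero    φ = φ []
  allAssignments (suc k) φ = allAssignments k (φ ∘ (true ∷_)) ∧ allAssignments k (φ ∘ (false ∷_))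

  allAssignments-sound : ∀ k φ → T (allAssignments k φ) → ∀ v → T (φ v)
  allAssignments-sound zero    φ holds []          = holds
  allAssignments-sound (suc k) φ holds (true ∷ v)  =
    allAssignments-sound k _ (proj₁ (Equivalence.to T-∧ holds)) v
  allAssignments-sound (suc k) φ holds (false ∷ v) =
    allAssignments-sound k _ (proj₂ (Equivalence.to T-∧ holds)) v

  -- f gives the two sides of a pointwise fact as functions of k booleans; for a closed f the
  -- hypothesis computes to ⊤, so callers pass _ for it and the actual booleans as v.
  truthTable-≤ : ∀ k (f : Vec Bool k → ℕ × ℕ) →
                 T (allAssignments k (λ v → proj₁ (f v) ≤ᵇ proj₂ (f v))) →
                 ∀ v → proj₁ (f v) ≤ proj₂ (f v)
  truthTable-≤ k f holds v = ℕP.≤ᵇ⇒≤ _ _ (allAssignments-sound k _ holds v)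

  truthTable-≡ : ∀ k (f : Vec Bool k → ℕ × ℕ) →
                 T (allAssignments k (λ v → proj₁ (f v) ≡ᵇ proj₂ (f v))) →
                 ∀ v → proj₁ (f v) ≡ proj₂ (f v)
  truthTable-≡ k f holds v = ℕP.≡ᵇ⇒≡ _ _ (allAssignments-sound k _ holds v)

open Counting

module Neighbourhoods {n} (G : Graph n) where

  open import Data.Nat using (_+_; _≤_)

  nbrsIn : (Fin n → Bool) → Fin n → ℕ
  nbrsIn S x = # (λ y → adj G x y ∧ S y)

  nonNbrsIn : (Fin n → Bool) → Fin n → ℕ
  nonNbrsIn S x = # (λ y → S y ∧ not (adj G x y))

  deg : Fin n → ℕ
  deg x = # (adj G x)

  ∣N∣≡deg : ∀ x → ∣ N G x ∣ ≡ deg x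
  ∣N∣≡deg x = ∣∣≡#-cong (N G x) (lookup∘tabulate (adj G x))

  nonNbrs+deg : ∀ S x → nonNbrsIn (not ∘ S) x + deg x ≡ # (not ∘ S) + nbrsIn S x
  nonNbrs+deg S x = #-+-≡ λ y → truthTable-≡ 2
    (λ { (s ∷ w ∷ []) → χ (not s ∧ not w) + χ w , χ (not s) + χ (w ∧ s) }) _ (S y ∷ adj G x y ∷ [])

  nonNbrsOutside≤nbrsIn : ∀ S → (∀ x → n ≤ deg x + # S) → ∀ x → nonNbrsIn (not ∘ S) x ≤ nbrsIn S x
  nonNbrsOutside≤nbrsIn S mindeg x = ℕP.+-cancelʳ-≤ (deg x) _ _ (begin
    nonNbrsIn (not ∘ S) x + deg x ≡⟨ nonNbrs+deg S x ⟩
    # (not ∘ S) + nbrsIn S x      ≤⟨ ℕP.+-monoˡ-≤ (nbrsIn S x) outside≤deg ⟩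
    deg x + nbrsIn S x            ≡⟨ ℕP.+-comm (deg x) (nbrsIn S x) ⟩
    nbrsIn S x + deg x            ∎)
    where
    open ℕP.≤-Reasoning
    outside≤deg : # (not ∘ S) ≤ deg x
    outside≤deg = ℕP.+-cancelʳ-≤ (# S) _ _
      (subst (_≤ deg x + # S) (sym (#-complement S)) (mindeg x))

module Split {n} (G : Graph n) (X : Subset n) where

  open import Data.Nat using (_+_; _*_; _≤_; _<ᵇ_)
  open Neighbourhoods G public

  inX : Fin n → Bool
  inX = lookup X

  edgeInX crossNonEdge orderedEdge : Fin n → Fin n → Bool
  edgeInX x y = inX x ∧ (adj G x y ∧ inX y)
  crossNonEdge x y = inX x ∧ (not (inX y) ∧ not (adj G x y))
  orderedEdge x y = inX x ∧ (inX y ∧ (adj G x y ∧ (toℕ x <ᵇ toℕ y)))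

  crossNonEdgesAt : Fin n → ℕ
  crossNonEdgesAt y = # (λ x → crossNonEdge x y)

  edgesIn≡#²orderedEdge : edgesIn G X ≡ #² orderedEdge
  edgesIn≡#²orderedEdge = trans (Σv≡sum atSmallerEnd) (sum-cong-≗ λ x →
    trans (cong (λ k → if inX x then k else 0) (∣∣≡#-cong (X ∩ (N G x ∩ later x)) λ y →
            trans (lookup-zipWith _∧_ y X _) (cong (inX y ∧_) (trans (lookup-zipWith _∧_ y (N G x) _)
              (cong₂ _∧_ (lookup∘tabulate (adj G x) y) (lookup∘tabulate (λ y → toℕ x <ᵇ toℕ y) y))))))
          (if-# (inX x) (λ y → inX y ∧ (adj G x y ∧ (toℕ x <ᵇ toℕ y)))))
    where
    later : Fin n → Subset n
    later x = tabulate (λ y → toℕ x <ᵇ toℕ y)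
    atSmallerEnd : Fin n → ℕ
    atSmallerEnd x = if inX x then ∣ X ∩ (N G x ∩ later x) ∣ else 0

  degreeSum≤2edges : #² edgeInX ≤ #² orderedEdge + #² orderedEdge
  degreeSum≤2edges = begin
    #² edgeInX
      ≤⟨ sum-mono-≤ (λ x → sum-mono-≤ (counted-once x)) ⟩
    sum (λ x → sum (λ y → χ (orderedEdge x y) + χ (orderedEdge y x)))
      ≡⟨ sum-cong-≗ (λ x → ∑-distrib-+ (χ ∘ orderedEdge x) (λ y → χ (orderedEdge y x))) ⟩
    sum (λ x → # (orderedEdge x) + sum (λ y → χ (orderedEdge y x)))
      ≡⟨ ∑-distrib-+ (# ∘ orderedEdge) (λ x → sum (λ y → χ (orderedEdge y x))) ⟩
    #² orderedEdge + sum (λ x → sum (λ y → χ (orderedEdge y x)))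
      ≡⟨ cong (#² orderedEdge +_) (∑-comm (λ x y → χ (orderedEdge y x))) ⟩
    #² orderedEdge + #² orderedEdge ∎
    where
    open ℕP.≤-Reasoning
    counted-once : ∀ x y → χ (edgeInX x y) ≤ χ (orderedEdge x y) + χ (orderedEdge y x)
    counted-once x y with FinP.<-cmp x y
    ... | tri< x<y _ _ rewrite Equivalence.to T-≡ (ℕP.<⇒<ᵇ x<y) =
      ℕP.≤-trans (truthTable-≤ 3 (λ { (u ∷ v ∷ w ∷ []) → χ (u ∧ (w ∧ v)) , χ (u ∧ (v ∧ (w ∧ true))) }) _
                                 (inX x ∷ inX y ∷ adj G x y ∷ []))
                 (ℕP.m≤m+n _ _)
    ... | tri> _ _ y<x rewrite Equivalence.to T-≡ (ℕP.<⇒<ᵇ y<x) | Graph.sym G y x =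
      ℕP.≤-trans (truthTable-≤ 3 (λ { (u ∷ v ∷ w ∷ []) → χ (u ∧ (w ∧ v)) , χ (v ∧ (u ∧ (w ∧ true))) }) _
                                 (inX x ∷ inX y ∷ adj G x y ∷ []))
                 (ℕP.m≤n+m _ _)
    ... | tri≈ _ refl _ rewrite Graph.irrefl G x | ∧-zeroʳ (inX x) = ℕ.z≤n

  #edgeInX≡nbrsIn : ∀ x → T (inX x) → # (edgeInX x) ≡ nbrsIn inX x
  #edgeInX≡nbrsIn x x∈X with inX x
  ... | true = refl

  crossNonEdges≡sum-crossNonEdgesAt : #² crossNonEdge ≡ sum crossNonEdgesAt
  crossNonEdges≡sum-crossNonEdgesAt = ∑-comm (λ x y → χ (crossNonEdge x y))

  crossNonEdges≤degreeSum : (∀ x → n ≤ deg x + # inX) → #² crossNonEdge ≤ #² edgeInX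
  crossNonEdges≤degreeSum mindeg = sum-mono-≤ row
    where
    row : ∀ x → # (crossNonEdge x) ≤ # (edgeInX x)
    row x with inX x
    ... | true  = nonNbrsOutside≤nbrsIn inX mindeg x
    ... | false = ℕP.≤-refl

  module Prune (bad : Fin n → Bool) where

    inB inX∖B : Fin n → Bool
    inB x = inX x ∧ bad x
    inX∖B x = inX x ∧ not (bad x)

    #inX≤crossNonEdgesAt+nbrsInX∖B+#inB : ∀ y → inX y ≡ false → # inX ≤ crossNonEdgesAt y + nbrsIn inX∖B y + # inB
    #inX≤crossNonEdgesAt+nbrsInX∖B+#inB y y∉X = begin
      # inX                                                           ≤⟨ sum-mono-≤ covered ⟩
      sum (λ x → (χ (crossNonEdge x y) + χ (adj G y x ∧ inX∖B x)) + χ (inB x))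
        ≡⟨ ∑-distrib-+ (λ x → χ (crossNonEdge x y) + χ (adj G y x ∧ inX∖B x)) (χ ∘ inB) ⟩
      sum (λ x → χ (crossNonEdge x y) + χ (adj G y x ∧ inX∖B x)) + # inB
        ≡⟨ cong (_+ # inB) (∑-distrib-+ (λ x → χ (crossNonEdge x y)) (λ x → χ (adj G y x ∧ inX∖B x))) ⟩
      crossNonEdgesAt y + nbrsIn inX∖B y + # inB                      ∎
      where
      open ℕP.≤-Reasoning
      covered : ∀ x → χ (inX x) ≤ χ (inX x ∧ (not (inX y) ∧ not (adj G x y))) + χ (adj G y x ∧ inX∖B x) + χ (inB x)
      covered x rewrite y∉X | Graph.sym G y x = truthTable-≤ 3
        (λ { (u ∷ r ∷ w ∷ []) → χ u , χ (u ∧ not w) + χ (w ∧ (u ∧ not r)) + χ (u ∧ r) }) _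
        (inX x ∷ bad x ∷ adj G x y ∷ [])

    module Complete (low : Fin n → Bool) where

      inC inA₁ : Fin n → Bool
      inC y = not (inX y) ∧ low y
      inA₁ x = inX∖B x ∨ inC x

      A₁ : Subset n
      A₁ = tabulate inA₁

      crossNonEdgeA₁ : Fin n → Fin n → Bool
      crossNonEdgeA₁ x y = inA₁ x ∧ (not (inA₁ y) ∧ not (adj G x y))

      ∉A₁-cases : ∀ x → T (not (inA₁ x)) → T (inB x) ⊎ T (not (inX x) ∧ not (low x))
      ∉A₁-cases x = cases (inX x) (bad x) (low x)
        where
        cases : ∀ u r s → T (not ((u ∧ not r) ∨ (not u ∧ s))) → T (u ∧ r) ⊎ T (not u ∧ not s)
        cases true  true  _     _ = inj₁ _
        cases false _     false _ = inj₂ _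

      ∣A₁∣≡ : ∣ A₁ ∣ ≡ # inA₁
      ∣A₁∣≡ = ∣∣≡#-cong A₁ (lookup∘tabulate inA₁)

      ∣∁A₁∖N∣≡ : ∀ x → ∣ ∁ A₁ ∩ ∁ (N G x) ∣ ≡ nonNbrsIn (not ∘ inA₁) x
      ∣∁A₁∖N∣≡ x = ∣∣≡#-cong (∁ A₁ ∩ ∁ (N G x)) λ y → trans (lookup-zipWith _∧_ y (∁ A₁) (∁ (N G x)))
        (cong₂ _∧_ (trans (lookup-map y not A₁) (cong not (lookup∘tabulate inA₁ y)))
                   (trans (lookup-map y not (N G x)) (cong not (lookup∘tabulate (adj G x) y))))

      ∣N∩A₁∣≡ : ∀ x → ∣ N G x ∩ A₁ ∣ ≡ nbrsIn inA₁ x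
      ∣N∩A₁∣≡ x = ∣∣≡#-cong (N G x ∩ A₁) λ y → trans (lookup-zipWith _∧_ y (N G x) A₁)
        (cong₂ _∧_ (lookup∘tabulate (adj G x) y) (lookup∘tabulate inA₁ y))

      nonEdgesBetween≡#²crossNonEdgeA₁ : nonEdgesBetween G A₁ (∁ A₁) ≡ #² crossNonEdgeA₁
      nonEdgesBetween≡#²crossNonEdgeA₁ = trans (Σv≡sum fromA₁) (sum-cong-≗ λ x →
        trans (cong₂ (λ b k → if b then k else 0) (lookup∘tabulate inA₁ x) (∣∁A₁∖N∣≡ x))
              (if-# (inA₁ x) (λ y → not (inA₁ y) ∧ not (adj G x y))))
        where
        fromA₁ : Fin n → ℕ
        fromA₁ x = if lookup A₁ x then ∣ ∁ A₁ ∩ ∁ (N G x) ∣ else 0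

      #inA₁+#inB≡#inX+#inC : # inA₁ + # inB ≡ # inX + # inC
      #inA₁+#inB≡#inX+#inC = #-+-≡ λ x → truthTable-≡ 3
        (λ { (u ∷ r ∷ s ∷ []) → χ ((u ∧ not r) ∨ (not u ∧ s)) + χ (u ∧ r) , χ u + χ (not u ∧ s) }) _
        (inX x ∷ bad x ∷ low x ∷ [])

      nbrsInX≤nbrsInA₁+#inB : ∀ x → nbrsIn inX x ≤ nbrsIn inA₁ x + # inB
      nbrsInX≤nbrsInA₁+#inB x = #-≤-+ λ y → truthTable-≤ 4
        (λ { (u ∷ r ∷ s ∷ w ∷ []) → χ (w ∧ u) , χ (w ∧ ((u ∧ not r) ∨ (not u ∧ s))) + χ (u ∧ r) }) _
        (inX y ∷ bad y ∷ low y ∷ adj G x y ∷ [])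

      nbrsInX∖B≤nbrsInA₁ : ∀ x → nbrsIn inX∖B x ≤ nbrsIn inA₁ x
      nbrsInX∖B≤nbrsInA₁ x = sum-mono-≤ λ y → truthTable-≤ 4
        (λ { (u ∷ r ∷ s ∷ w ∷ []) → χ (w ∧ (u ∧ not r)) , χ (w ∧ ((u ∧ not r) ∨ (not u ∧ s))) }) _
        (inX y ∷ bad y ∷ low y ∷ adj G x y ∷ [])

      nbrsInA₁≤nbrsInX∖B+#inC : ∀ x → nbrsIn inA₁ x ≤ nbrsIn inX∖B x + # inC
      nbrsInA₁≤nbrsInX∖B+#inC x = #-≤-+ λ y → truthTable-≤ 4
        (λ { (u ∷ r ∷ s ∷ w ∷ []) → χ (w ∧ ((u ∧ not r) ∨ (not u ∧ s))) , χ (w ∧ (u ∧ not r)) + χ (not u ∧ s) }) _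
        (inX y ∷ bad y ∷ low y ∷ adj G x y ∷ [])

      crossNonEdgesA₁≤crossNonEdges+n*#inB+n*#inC : #² crossNonEdgeA₁ ≤ #² crossNonEdge + (n * # inB + n * # inC)
      crossNonEdgesA₁≤crossNonEdges+n*#inB+n*#inC = begin
        #² crossNonEdgeA₁
          ≤⟨ sum-mono-≤ (λ x → sum-mono-≤ (covered x)) ⟩
        sum (λ x → sum (λ y → χ (crossNonEdge x y) + (χ (inB y) + χ (inC x))))
          ≡⟨ sum-cong-≗ (λ x → trans (∑-distrib-+ (χ ∘ crossNonEdge x) (λ y → χ (inB y) + χ (inC x)))
                                     (cong (# (crossNonEdge x) +_) (∑-distrib-+ (χ ∘ inB) (λ _ → χ (inC x))))) ⟩
        sum (λ x → # (crossNonEdge x) + (# inB + sum {n} (λ _ → χ (inC x))))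
          ≡⟨ trans (∑-distrib-+ (# ∘ crossNonEdge) (λ x → # inB + sum {n} (λ _ → χ (inC x))))
                   (cong (#² crossNonEdge +_) (∑-distrib-+ (λ _ → # inB) (λ x → sum {n} (λ _ → χ (inC x))))) ⟩
        #² crossNonEdge + (sum {n} (λ _ → # inB) + sum (λ x → sum {n} (λ _ → χ (inC x))))
          ≡⟨ cong (λ k → #² crossNonEdge + (sum {n} (λ _ → # inB) + k)) (∑-comm (λ x (_ : Fin n) → χ (inC x))) ⟩
        #² crossNonEdge + (sum {n} (λ _ → # inB) + sum {n} (λ _ → # inC))
          ≡⟨ cong (#² crossNonEdge +_) (cong₂ _+_ (sum-const n (# inB)) (sum-const n (# inC))) ⟩
        #² crossNonEdge + (n * # inB + n * # inC) ∎
        where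
        open ℕP.≤-Reasoning
        covered : ∀ x y → χ (crossNonEdgeA₁ x y) ≤ χ (crossNonEdge x y) + (χ (inB y) + χ (inC x))
        covered x y = truthTable-≤ 7
          (λ { (u ∷ r ∷ s ∷ u′ ∷ r′ ∷ s′ ∷ w ∷ []) →
                 χ (((u ∧ not r) ∨ (not u ∧ s)) ∧ (not ((u′ ∧ not r′) ∨ (not u′ ∧ s′)) ∧ not w))
               , χ (u ∧ (not u′ ∧ not w)) + (χ (u′ ∧ r′) + χ (not u ∧ s)) }) _
          (inX x ∷ bad x ∷ low x ∷ inX y ∷ bad y ∷ low y ∷ adj G x y ∷ [])

      nonNbrsOutsideA₁≤nbrsInX+#inB : (∀ x → n ≤ deg x + # inX) →
                                 ∀ x → nonNbrsIn (not ∘ inA₁) x ≤ nbrsIn inX x + # inB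
      nonNbrsOutsideA₁≤nbrsInX+#inB mindeg x = ℕP.≤-trans
        (#-≤-+ λ y → truthTable-≤ 4
          (λ { (u ∷ r ∷ s ∷ w ∷ []) → χ (not ((u ∧ not r) ∨ (not u ∧ s)) ∧ not w)
                                    , χ (not u ∧ not w) + χ (u ∧ r) }) _
          (inX y ∷ bad y ∷ low y ∷ adj G x y ∷ []))
        (ℕP.+-monoˡ-≤ (# inB) (nonNbrsOutside≤nbrsIn inX mindeg x))

      nonNbrsOutsideA₁≤nbrsInX∖B+#inB : (∀ x → n ≤ deg x + # inX) →
                                   ∀ x → nonNbrsIn (not ∘ inA₁) x ≤ nbrsIn inX∖B x + # inB
      nonNbrsOutsideA₁≤nbrsInX∖B+#inB mindeg x = ℕP.+-cancelʳ-≤ (deg x + # inX + # inC) _ _ (begin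
        Z + (deg x + # inX + # inC)               ≡⟨ regroup₁ Z (deg x) (# inX) (# inC) ⟩
        (Z + deg x) + (# inX + # inC)             ≡⟨ cong₂ _+_ (nonNbrs+deg inA₁ x) (sym #inA₁+#inB≡#inX+#inC) ⟩
        (# (not ∘ inA₁) + K) + (# inA₁ + # inB)   ≡⟨ regroup₂ (# (not ∘ inA₁)) K (# inA₁) (# inB) ⟩
        (# (not ∘ inA₁) + # inA₁) + (K + # inB)   ≡⟨ cong (_+ (K + # inB)) (#-complement inA₁) ⟩
        n + (K + # inB)                           ≤⟨ ℕP.+-mono-≤ (mindeg x)
                                                         (ℕP.+-monoˡ-≤ (# inB) (nbrsInA₁≤nbrsInX∖B+#inC x)) ⟩
        (deg x + # inX) + (t + # inC + # inB)     ≡⟨ regroup₃ (deg x) (# inX) t (# inC) (# inB) ⟩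
        (t + # inB) + (deg x + # inX + # inC)     ∎)
        where
        open ℕP.≤-Reasoning
        open ℕ-Solver.+-*-Solver using (solve; _:+_; _:=_)
        Z K t : ℕ
        Z = nonNbrsIn (not ∘ inA₁) x
        K = nbrsIn inA₁ x
        t = nbrsIn inX∖B x
        regroup₁ : ∀ z d m c → z + (d + m + c) ≡ (z + d) + (m + c)
        regroup₁ = solve 4 (λ z d m c → z :+ (d :+ m :+ c) := (z :+ d) :+ (m :+ c)) refl
        regroup₂ : ∀ a k a₁ b → (a + k) + (a₁ + b) ≡ (a + a₁) + (k + b)
        regroup₂ = solve 4 (λ a k a₁ b → (a :+ k) :+ (a₁ :+ b) := (a :+ a₁) :+ (k :+ b)) refl
        regroup₃ : ∀ d m t c b → (d + m) + (t + c + b) ≡ (t + b) + (d + m + c)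
        regroup₃ = solve 5 (λ d m t c b → (d :+ m) :+ (t :+ c :+ b) := (t :+ b) :+ (d :+ m :+ c)) refl

import Data.Integer as ℤ
import Data.Integer.Properties as ℤP
open import Data.Rational using (ℚ; 0ℚ; 1ℚ; _+_; _-_; -_; _*_; _≤_; _<_; NonNegative; Positive; positive; nonNegative; toℚᵘ)
open import Data.Rational.Properties
import Data.Rational.Unnormalised as ℚᵘ
import Data.Rational.Unnormalised.Properties as ℚᵘP
open import Data.Rational.Solver using (module +-*-Solver)
open +-*-Solver using (solve; _:=_; con; _:+_; _:*_; _:-_; :-_)

toℚᵘ-⟦⟧ : ∀ k → toℚᵘ ⟦ k ⟧ ≡ ℚᵘ.mkℚᵘ (ℤ.+ k) 0
toℚᵘ-⟦⟧ k = cong toℚᵘ (normalize-coprime (Coprime.sym (Coprime.1-coprimeTo k)))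

⟦⟧-homo-+ : ∀ a b → ⟦ a ℕ.+ b ⟧ ≡ ⟦ a ⟧ + ⟦ b ⟧
⟦⟧-homo-+ a b = toℚᵘ-injective (begin
  toℚᵘ ⟦ a ℕ.+ b ⟧                          ≡⟨ toℚᵘ-⟦⟧ (a ℕ.+ b) ⟩
  ℚᵘ.mkℚᵘ (ℤ.+ (a ℕ.+ b)) 0                   ≈⟨ ℚᵘ.*≡* integers ⟩
  ℚᵘ.mkℚᵘ (ℤ.+ a) 0 ℚᵘ.+ ℚᵘ.mkℚᵘ (ℤ.+ b) 0      ≡⟨ cong₂ ℚᵘ._+_ (toℚᵘ-⟦⟧ a) (toℚᵘ-⟦⟧ b) ⟨
  toℚᵘ ⟦ a ⟧ ℚᵘ.+ toℚᵘ ⟦ b ⟧                 ≈⟨ toℚᵘ-homo-+ ⟦ a ⟧ ⟦ b ⟧ ⟨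
  toℚᵘ (⟦ a ⟧ + ⟦ b ⟧)                       ∎)
  where
  open ℚᵘP.≃-Reasoning
  integers : ℤ.+ (a ℕ.+ b) ℤ.* ℤ.+ 1 ≡ (ℤ.+ a ℤ.* ℤ.+ 1 ℤ.+ ℤ.+ b ℤ.* ℤ.+ 1) ℤ.* ℤ.+ 1
  integers rewrite ℤP.*-identityʳ (ℤ.+ (a ℕ.+ b)) | ℤP.*-identityʳ (ℤ.+ a) | ℤP.*-identityʳ (ℤ.+ b)
    = sym (trans (ℤP.*-identityʳ (ℤ.+ a ℤ.+ ℤ.+ b)) (sym (ℤP.pos-+ a b)))

⟦⟧-homo-* : ∀ a b → ⟦ a ℕ.* b ⟧ ≡ ⟦ a ⟧ * ⟦ b ⟧
⟦⟧-homo-* a b = toℚᵘ-injective (begin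
  toℚᵘ ⟦ a ℕ.* b ⟧                          ≡⟨ toℚᵘ-⟦⟧ (a ℕ.* b) ⟩
  ℚᵘ.mkℚᵘ (ℤ.+ (a ℕ.* b)) 0                   ≈⟨ ℚᵘ.*≡* (cong (ℤ._* ℤ.+ 1) (ℤP.pos-* a b)) ⟩
  ℚᵘ.mkℚᵘ (ℤ.+ a) 0 ℚᵘ.* ℚᵘ.mkℚᵘ (ℤ.+ b) 0      ≡⟨ cong₂ ℚᵘ._*_ (toℚᵘ-⟦⟧ a) (toℚᵘ-⟦⟧ b) ⟨
  toℚᵘ ⟦ a ⟧ ℚᵘ.* toℚᵘ ⟦ b ⟧                 ≈⟨ toℚᵘ-homo-* ⟦ a ⟧ ⟦ b ⟧ ⟨
  toℚᵘ (⟦ a ⟧ * ⟦ b ⟧)                       ∎)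
  where open ℚᵘP.≃-Reasoning

⟦⟧-mono-≤ : ∀ {a b} → a ℕ.≤ b → ⟦ a ⟧ ≤ ⟦ b ⟧
⟦⟧-mono-≤ {a} {b} a≤b = toℚᵘ-cancel-≤ (subst₂ ℚᵘ._≤_ (sym (toℚᵘ-⟦⟧ a)) (sym (toℚᵘ-⟦⟧ b))
  (ℚᵘ.*≤* (ℤP.*-monoʳ-≤-nonNeg (ℤ.+ 1) (ℤ.+≤+ a≤b))))

⟦⟧-mono-< : ∀ {a b} → a ℕ.< b → ⟦ a ⟧ < ⟦ b ⟧
⟦⟧-mono-< {a} {b} a<b = toℚᵘ-cancel-< (subst₂ ℚᵘ._<_ (sym (toℚᵘ-⟦⟧ a)) (sym (toℚᵘ-⟦⟧ b))
  (ℚᵘ.*<* (ℤP.*-monoʳ-<-pos (ℤ.+ 1) (ℤ.+<+ a<b))))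

⟦⟧-cancel-≤ : ∀ {a b} → ⟦ a ⟧ ≤ ⟦ b ⟧ → a ℕ.≤ b
⟦⟧-cancel-≤ {a} {b} ⟦a⟧≤⟦b⟧ with subst₂ ℚᵘ._≤_ (toℚᵘ-⟦⟧ a) (toℚᵘ-⟦⟧ b) (toℚᵘ-mono-≤ ⟦a⟧≤⟦b⟧)
... | ℚᵘ.*≤* a*1≤b*1 = ℤP.drop‿+≤+ (subst₂ ℤ._≤_ (ℤP.*-identityʳ (ℤ.+ a)) (ℤP.*-identityʳ (ℤ.+ b)) a*1≤b*1)

⟦⟧-nonNeg : ∀ k → 0ℚ ≤ ⟦ k ⟧
⟦⟧-nonNeg k = ⟦⟧-mono-≤ {0} {k} ℕ.z≤n

open ≤-Reasoning

1≤⟦1+k⟧ : ∀ k → 1ℚ ≤ ⟦ suc k ⟧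
1≤⟦1+k⟧ k = ⟦⟧-mono-≤ {1} {suc k} (ℕ.s≤s ℕ.z≤n)

markov : ∀ {n} (P : Fin n → Bool) (f : Fin n → ℕ) (c : ℚ) → (∀ i → T (P i) → c ≤ ⟦ f i ⟧) →
         ⟦ # P ⟧ * c ≤ ⟦ sum f ⟧
markov {zero}  P f c _   = ≤-reflexive (*-zeroˡ c)
markov {suc n} P f c c≤f = begin
  ⟦ χ (P zero) ℕ.+ # (P ∘ suc) ⟧ * c        ≡⟨ cong (_* c) (⟦⟧-homo-+ (χ (P zero)) (# (P ∘ suc))) ⟩
  (⟦ χ (P zero) ⟧ + ⟦ # (P ∘ suc) ⟧) * c    ≡⟨ *-distribʳ-+ c ⟦ χ (P zero) ⟧ ⟦ # (P ∘ suc) ⟧ ⟩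
  ⟦ χ (P zero) ⟧ * c + ⟦ # (P ∘ suc) ⟧ * c  ≤⟨ +-mono-≤ (head (P zero) (c≤f zero))
                                                         (markov (P ∘ suc) (f ∘ suc) c (c≤f ∘ suc)) ⟩
  ⟦ f zero ⟧ + ⟦ sum (f ∘ suc) ⟧            ≡⟨ ⟦⟧-homo-+ (f zero) (sum (f ∘ suc)) ⟨
  ⟦ sum f ⟧                                 ∎
  where
  head : ∀ b → (T b → c ≤ ⟦ f zero ⟧) → ⟦ χ b ⟧ * c ≤ ⟦ f zero ⟧
  head true  c≤f₀ = ≤-trans (≤-reflexive (*-identityˡ c)) (c≤f₀ _)
  head false _    = ≤-trans (≤-reflexive (*-zeroˡ c)) (⟦⟧-nonNeg (f zero))

k*[3b]<2g²⇒k*12<g : ∀ k b g .{{_ : Positive b}} .{{_ : NonNegative g}} → ⟦ 8 ⟧ * g ≤ b →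
                    k * (⟦ 3 ⟧ * b) < ⟦ 2 ⟧ * (g * g) → k * ⟦ 12 ⟧ < g
k*[3b]<2g²⇒k*12<g k b g 8g≤b k3b<2gg =
  *-cancelʳ-<-nonNeg (⟦ 3 ⟧ * b) {{nonNeg*nonNeg⇒nonNeg ⟦ 3 ⟧ b {{pos⇒nonNeg b}}}} (begin-strict
  k * ⟦ 12 ⟧ * (⟦ 3 ⟧ * b)      ≡⟨ solve 2 (λ k b → k :* con ⟦ 12 ⟧ :* (con ⟦ 3 ⟧ :* b)
                                             := con ⟦ 12 ⟧ :* (k :* (con ⟦ 3 ⟧ :* b))) refl k b ⟩
  ⟦ 12 ⟧ * (k * (⟦ 3 ⟧ * b))    <⟨ *-monoʳ-<-pos ⟦ 12 ⟧ k3b<2gg ⟩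
  ⟦ 12 ⟧ * (⟦ 2 ⟧ * (g * g))    ≡⟨ solve 1 (λ g → con ⟦ 12 ⟧ :* (con ⟦ 2 ⟧ :* (g :* g))
                                             := (con ⟦ 3 ⟧ :* g) :* (con ⟦ 8 ⟧ :* g)) refl g ⟩
  (⟦ 3 ⟧ * g) * (⟦ 8 ⟧ * g)     ≤⟨ *-monoˡ-≤-nonNeg (⟦ 3 ⟧ * g) {{nonNeg*nonNeg⇒nonNeg ⟦ 3 ⟧ g}} 8g≤b ⟩
  (⟦ 3 ⟧ * g) * b               ≡⟨ solve 2 (λ g b → (con ⟦ 3 ⟧ :* g) :* b := g :* (con ⟦ 3 ⟧ :* b)) refl g b ⟩
  g * (⟦ 3 ⟧ * b)               ∎)

p≤c*p : ∀ c p .{{_ : NonNegative p}} → 1ℚ ≤ c → p ≤ c * p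
p≤c*p c p 1≤c = subst (_≤ c * p) (*-identityˡ p) (*-monoʳ-≤-nonNeg p 1≤c)

k*12<g⇒k≤g : ∀ k g .{{_ : NonNegative k}} → k * ⟦ 12 ⟧ < g → k ≤ g
k*12<g⇒k≤g k g k*12<g = <⇒≤ (≤-<-trans (subst (k ≤_) (*-comm ⟦ 12 ⟧ k) (p≤c*p ⟦ 12 ⟧ k (1≤⟦1+k⟧ 11))) k*12<g)

5b≤c+t+B⇒3b≤c : ∀ c t B b → ⟦ 5 ⟧ * b ≤ c + t + B → t < b → B ≤ b → ⟦ 3 ⟧ * b ≤ c
5b≤c+t+B⇒3b≤c c t B b 5b≤c+t+B t<b B≤b = begin
  ⟦ 3 ⟧ * b                 ≡⟨ solve 1 (λ b → con ⟦ 3 ⟧ :* b := con ⟦ 5 ⟧ :* b :+ :- b :+ :- b) refl b ⟩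
  ⟦ 5 ⟧ * b - b - b         ≤⟨ +-monoˡ-≤ (- b) (+-monoˡ-≤ (- b) (≤-trans 5b≤c+t+B
                                 (+-mono-≤ (+-monoʳ-≤ c (<⇒≤ t<b)) B≤b))) ⟩
  c + b + b - b - b         ≡⟨ solve 2 (λ c b → c :+ b :+ b :+ :- b :+ :- b := c) refl c b ⟩
  c                         ∎

m≤A+B⇒m-g≤A : ∀ m A B g → m ≤ A + B → B ≤ g → m - g ≤ A
m≤A+B⇒m-g≤A m A B g m≤A+B B≤g = begin
  m - g         ≤⟨ +-mono-≤ m≤A+B (neg-antimono-≤ B≤g) ⟩
  A + B - B     ≡⟨ solve 2 (λ A B → A :+ B :+ :- B := A) refl A B ⟩
  A             ∎

Z≤w+B⇒Z≤4b : ∀ Z w B b → Z ≤ w + B → w ≤ ⟦ 3 ⟧ * b → B ≤ b → Z ≤ ⟦ 4 ⟧ * b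
Z≤w+B⇒Z≤4b Z w B b Z≤w+B w≤3b B≤b = begin
  Z                 ≤⟨ Z≤w+B ⟩
  w + B             ≤⟨ +-mono-≤ w≤3b B≤b ⟩
  ⟦ 3 ⟧ * b + b     ≡⟨ solve 1 (λ b → con ⟦ 3 ⟧ :* b :+ b := con ⟦ 4 ⟧ :* b) refl b ⟩
  ⟦ 4 ⟧ * b         ∎

3b<K+B⇒b≤K : ∀ K B b .{{_ : NonNegative b}} → ⟦ 3 ⟧ * b < K + B → B ≤ b → b ≤ K
3b<K+B⇒b≤K K B b 3b<K+B B≤b = <⇒≤ (begin-strict
  b                     ≡⟨ solve 1 (λ b → b := con ⟦ 3 ⟧ :* b :+ :- b :+ :- b) refl b ⟩
  ⟦ 3 ⟧ * b - b - b     <⟨ +-monoˡ-< (- b) (+-monoˡ-< (- b) 3b<K+B) ⟩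
  K + B - b - b         ≤⟨ +-monoˡ-≤ (- b) (+-monoˡ-≤ (- b) (+-monoʳ-≤ K B≤b)) ⟩
  K + b - b - b         ≡⟨ solve 2 (λ K b → K :+ b :+ :- b :+ :- b := K :+ :- b) refl K b ⟩
  K - b                 ≤⟨ +-monoʳ-≤ K (neg-antimono-≤ (nonNegative⁻¹ b)) ⟩
  K - 0ℚ                ≡⟨ solve 1 (λ K → K :+ :- con 0ℚ := K) refl K ⟩
  K                     ∎)

-- The three contributions are at most 2g², ng/12 and ng/12, and 2g² ≤ ng/20 because g ≤ b/8 ≤ n/40.
N≤S+n[B+C]⇒N≤gn : ∀ N S n B C g b .{{_ : NonNegative n}} .{{_ : NonNegative g}} →
                  N ≤ S + (n * B + n * C) → S < ⟦ 2 ⟧ * (g * g) → B * ⟦ 12 ⟧ < g → C * ⟦ 12 ⟧ < g →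
                  ⟦ 8 ⟧ * g ≤ b → ⟦ 5 ⟧ * b ≤ n → N ≤ g * n
N≤S+n[B+C]⇒N≤gn N S n B C g b N≤ S<2gg 12B<g 12C<g 8g≤b 5b≤n = *-cancelʳ-≤-pos ⟦ 60 ⟧ (begin
  N * ⟦ 60 ⟧
    ≤⟨ *-monoʳ-≤-nonNeg ⟦ 60 ⟧ N≤ ⟩
  (S + (n * B + n * C)) * ⟦ 60 ⟧
    ≡⟨ solve 4 (λ S n B C → (S :+ (n :* B :+ n :* C)) :* con ⟦ 60 ⟧
                := con ⟦ 60 ⟧ :* S :+ con ⟦ 5 ⟧ :* (n :* (B :* con ⟦ 12 ⟧)) :+ con ⟦ 5 ⟧ :* (n :* (C :* con ⟦ 12 ⟧)))
             refl S n B C ⟩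
  ⟦ 60 ⟧ * S + ⟦ 5 ⟧ * (n * (B * ⟦ 12 ⟧)) + ⟦ 5 ⟧ * (n * (C * ⟦ 12 ⟧))
    ≤⟨ +-mono-≤ (+-mono-≤ (*-monoˡ-≤-nonNeg ⟦ 60 ⟧ (<⇒≤ S<2gg))
                          (*-monoˡ-≤-nonNeg ⟦ 5 ⟧ (*-monoˡ-≤-nonNeg n (<⇒≤ 12B<g))))
                (*-monoˡ-≤-nonNeg ⟦ 5 ⟧ (*-monoˡ-≤-nonNeg n (<⇒≤ 12C<g))) ⟩
  ⟦ 60 ⟧ * (⟦ 2 ⟧ * (g * g)) + ⟦ 5 ⟧ * (n * g) + ⟦ 5 ⟧ * (n * g)
    ≡⟨ solve 2 (λ g n → con ⟦ 60 ⟧ :* (con ⟦ 2 ⟧ :* (g :* g)) :+ con ⟦ 5 ⟧ :* (n :* g) :+ con ⟦ 5 ⟧ :* (n :* g)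
                := (con ⟦ 3 ⟧ :* g) :* (con ⟦ 5 ⟧ :* (con ⟦ 8 ⟧ :* g)) :+ con ⟦ 10 ⟧ :* (n :* g)) refl g n ⟩
  (⟦ 3 ⟧ * g) * (⟦ 5 ⟧ * (⟦ 8 ⟧ * g)) + ⟦ 10 ⟧ * (n * g)
    ≤⟨ +-monoˡ-≤ (⟦ 10 ⟧ * (n * g)) (*-monoˡ-≤-nonNeg (⟦ 3 ⟧ * g) {{nonNeg*nonNeg⇒nonNeg ⟦ 3 ⟧ g}}
         (≤-trans (*-monoˡ-≤-nonNeg ⟦ 5 ⟧ 8g≤b) 5b≤n)) ⟩
  (⟦ 3 ⟧ * g) * n + ⟦ 10 ⟧ * (n * g)
    ≡⟨ solve 2 (λ g n → (con ⟦ 3 ⟧ :* g) :* n :+ con ⟦ 10 ⟧ :* (n :* g) := con ⟦ 13 ⟧ :* (g :* n)) refl g n ⟩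
  ⟦ 13 ⟧ * (g * n)
    ≤⟨ *-monoʳ-≤-nonNeg (g * n) {{nonNeg*nonNeg⇒nonNeg g n}} (⟦⟧-mono-≤ {13} {60} (ℕP.m≤m+n 13 47)) ⟩
  ⟦ 60 ⟧ * (g * n)
    ≡⟨ *-comm ⟦ 60 ⟧ (g * n) ⟩
  g * n * ⟦ 60 ⟧ ∎)

StablePartition : (α γ β : ℚ) {n : ℕ} → Graph n → Subset n → Set
StablePartition α γ β {n} G A₁ =
    ((1ℚ - α - γ) * ⟦ n ⟧ ≤ ⟦ ∣ A₁ ∣ ⟧ × ⟦ ∣ A₁ ∣ ⟧ ≤ (1ℚ - α + γ) * ⟦ n ⟧)
  × (∀ x → x ∈ A₁ → ⟦ ∣ ∁ A₁ ∩ ∁ (N G x) ∣ ⟧ ≤ ⟦ 4 ⟧ * β * ⟦ n ⟧)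
  × (∀ x → x ∈ ∁ A₁ → β * ⟦ n ⟧ ≤ ⟦ ∣ N G x ∩ A₁ ∣ ⟧)
  × ⟦ nonEdgesBetween G A₁ (∁ A₁) ⟧ ≤ γ * ⟦ n ⟧ * ⟦ n ⟧

module Stability (α γ β : ℚ) (0<γ : 0ℚ < γ) (0<β : 0ℚ < β)
  (8γ<β : ⟦ 8 ⟧ * γ < β) (5β<1-α : ⟦ 5 ⟧ * β < 1ℚ - α)
  {n} (G : Graph n) (mindeg : ∀ x → α * ⟦ n ⟧ ≤ ⟦ ∣ N G x ∣ ⟧)
  (X : Subset n) (∣X∣≡ : ⟦ ∣ X ∣ ⟧ ≡ (1ℚ - α) * ⟦ n ⟧)
  (sparse : ¬ (γ * γ * ⟦ n ⟧ * ⟦ n ⟧ ≤ ⟦ edgesIn G X ⟧)) where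

  n̂ b g : ℚ
  n̂ = ⟦ n ⟧
  b = β * n̂
  g = γ * n̂

  open Split G X

  bad : Fin n → Bool
  bad x = isYes (⟦ 3 ⟧ * b <? ⟦ nbrsIn inX x ⟧)

  open Prune bad

  bad⇒dense : ∀ x → T (bad x) → ⟦ 3 ⟧ * b < ⟦ nbrsIn inX x ⟧
  bad⇒dense x = toWitness {a? = ⟦ 3 ⟧ * b <? ⟦ nbrsIn inX x ⟧}

  ¬bad⇒sparse : ∀ x → T (not (bad x)) → ⟦ nbrsIn inX x ⟧ ≤ ⟦ 3 ⟧ * b
  ¬bad⇒sparse x = ≮⇒≥ ∘ toWitnessFalse {a? = ⟦ 3 ⟧ * b <? ⟦ nbrsIn inX x ⟧}

  low : Fin n → Bool
  low y = isYes (⟦ nbrsIn inX∖B y ⟧ <? b)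

  open Complete low

  low⇒sparse : ∀ y → T (low y) → ⟦ nbrsIn inX∖B y ⟧ < b
  low⇒sparse y = toWitness {a? = ⟦ nbrsIn inX∖B y ⟧ <? b}

  ¬low⇒dense : ∀ y → T (not (low y)) → b ≤ ⟦ nbrsIn inX∖B y ⟧
  ¬low⇒dense y = ≮⇒≥ ∘ toWitnessFalse {a? = ⟦ nbrsIn inX∖B y ⟧ <? b}

  0<n̂ : 0ℚ < n̂
  0<n̂ = ⟦⟧-mono-< (ℕP.n≢0⇒n>0 n≢0)
    where
    n≢0 : n ≢ 0
    n≢0 n≡0 = sparse (subst (λ k → γ * γ * ⟦ k ⟧ * ⟦ k ⟧ ≤ ⟦ edgesIn G X ⟧) (sym n≡0)
                            (subst (_≤ ⟦ edgesIn G X ⟧) (sym (*-zeroʳ (γ * γ * 0ℚ))) (⟦⟧-nonNeg (edgesIn G X))))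

  instance
    n̂-pos : Positive n̂
    n̂-pos = positive 0<n̂
    β-pos : Positive β
    β-pos = positive 0<β
    γ-pos : Positive γ
    γ-pos = positive 0<γ
    b-pos : Positive b
    b-pos = pos*pos⇒pos β n̂
    n̂-nonNeg : NonNegative n̂
    n̂-nonNeg = pos⇒nonNeg n̂
    b-nonNeg : NonNegative b
    b-nonNeg = pos⇒nonNeg b
    g-nonNeg : NonNegative g
    g-nonNeg = pos⇒nonNeg (γ * n̂) {{pos*pos⇒pos γ n̂}}

  m̂ : ℚ
  m̂ = ⟦ # inX ⟧

  m̂≡ : m̂ ≡ (1ℚ - α) * n̂
  m̂≡ = trans (cong ⟦_⟧ (sym (∣∣≡# X))) ∣X∣≡

  8g≤b : ⟦ 8 ⟧ * g ≤ b
  8g≤b = subst (_≤ b) (*-assoc ⟦ 8 ⟧ γ n̂) (*-monoʳ-≤-nonNeg n̂ (<⇒≤ 8γ<β))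

  5b≤m̂ : ⟦ 5 ⟧ * b ≤ m̂
  5b≤m̂ = subst₂ _≤_ (*-assoc ⟦ 5 ⟧ β n̂) (sym m̂≡) (*-monoʳ-≤-nonNeg n̂ (<⇒≤ 5β<1-α))

  5b≤n̂ : ⟦ 5 ⟧ * b ≤ n̂
  5b≤n̂ = ≤-trans 5b≤m̂ (⟦⟧-mono-≤ (#≤n inX))

  mindegℕ : ∀ x → n ℕ.≤ deg x ℕ.+ # inX
  mindegℕ x = ⟦⟧-cancel-≤ (begin
    n̂                          ≡⟨ solve 2 (λ a n → n := a :* n :+ (con 1ℚ :- a) :* n) refl α n̂ ⟩
    α * n̂ + (1ℚ - α) * n̂      ≤⟨ +-mono-≤ (subst (λ k → α * n̂ ≤ ⟦ k ⟧) (∣N∣≡deg x) (mindeg x))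
                                            (≤-reflexive (sym m̂≡)) ⟩
    ⟦ deg x ⟧ + m̂              ≡⟨ ⟦⟧-homo-+ (deg x) (# inX) ⟨
    ⟦ deg x ℕ.+ # inX ⟧        ∎)

  degreeSum<2g² : ⟦ #² edgeInX ⟧ < ⟦ 2 ⟧ * (g * g)
  degreeSum<2g² = begin-strict
    ⟦ #² edgeInX ⟧                          ≤⟨ ⟦⟧-mono-≤ degreeSum≤2edges ⟩
    ⟦ #² orderedEdge ℕ.+ #² orderedEdge ⟧   ≡⟨ ⟦⟧-homo-+ (#² orderedEdge) (#² orderedEdge) ⟩
    ⟦ #² orderedEdge ⟧ + ⟦ #² orderedEdge ⟧ <⟨ +-mono-< e<g² e<g² ⟩
    g * g + g * g                           ≡⟨ solve 1 (λ g → g :+ g := con ⟦ 2 ⟧ :* g) refl (g * g) ⟩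
    ⟦ 2 ⟧ * (g * g)                         ∎
    where
    e<g² : ⟦ #² orderedEdge ⟧ < g * g
    e<g² = subst₂ _<_ (cong ⟦_⟧ edgesIn≡#²orderedEdge) (solve 2 (λ c n → c :* c :* n :* n := (c :* n) :* (c :* n)) refl γ n̂)
                  (≰⇒> sparse)

  few-B : ⟦ # inB ⟧ * ⟦ 12 ⟧ < g
  few-B = k*[3b]<2g²⇒k*12<g ⟦ # inB ⟧ b g 8g≤b
    (≤-<-trans (markov inB (# ∘ edgeInX) (⟦ 3 ⟧ * b) dense-in-X) degreeSum<2g²)
    where
    dense-in-X : ∀ x → T (inB x) → ⟦ 3 ⟧ * b ≤ ⟦ # (edgeInX x) ⟧
    dense-in-X x x∈B with Equivalence.to T-∧ x∈B
    ... | x∈X , x-bad = subst (λ k → ⟦ 3 ⟧ * b ≤ ⟦ k ⟧) (sym (#edgeInX≡nbrsIn x x∈X)) (<⇒≤ (bad⇒dense x x-bad))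

  B≤g : ⟦ # inB ⟧ ≤ g
  B≤g = k*12<g⇒k≤g ⟦ # inB ⟧ g {{nonNegative (⟦⟧-nonNeg (# inB))}} few-B

  B≤b : ⟦ # inB ⟧ ≤ b
  B≤b = ≤-trans B≤g (≤-trans (p≤c*p ⟦ 8 ⟧ g (1≤⟦1+k⟧ 7)) 8g≤b)

  few-C : ⟦ # inC ⟧ * ⟦ 12 ⟧ < g
  few-C = k*[3b]<2g²⇒k*12<g ⟦ # inC ⟧ b g 8g≤b (begin-strict
    ⟦ # inC ⟧ * (⟦ 3 ⟧ * b)   ≤⟨ markov inC crossNonEdgesAt (⟦ 3 ⟧ * b) sparse-to-X ⟩
    ⟦ sum crossNonEdgesAt ⟧    ≡⟨ cong ⟦_⟧ crossNonEdges≡sum-crossNonEdgesAt ⟨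
    ⟦ #² crossNonEdge ⟧        ≤⟨ ⟦⟧-mono-≤ (crossNonEdges≤degreeSum mindegℕ) ⟩
    ⟦ #² edgeInX ⟧             <⟨ degreeSum<2g² ⟩
    ⟦ 2 ⟧ * (g * g)            ∎)
    where
    sparse-to-X : ∀ y → T (inC y) → ⟦ 3 ⟧ * b ≤ ⟦ crossNonEdgesAt y ⟧
    sparse-to-X y y∈C with Equivalence.to T-∧ y∈C
    ... | y∉X , y-low = 5b≤c+t+B⇒3b≤c ⟦ crossNonEdgesAt y ⟧ ⟦ t ⟧ ⟦ # inB ⟧ b
      (≤-trans 5b≤m̂ (≤-trans (⟦⟧-mono-≤ (#inX≤crossNonEdgesAt+nbrsInX∖B+#inB y (Equivalence.to T-not-≡ y∉X)))
                             (≤-reflexive (trans (⟦⟧-homo-+ (crossNonEdgesAt y ℕ.+ t) (# inB))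
                                                 (cong (_+ ⟦ # inB ⟧) (⟦⟧-homo-+ (crossNonEdgesAt y) t))))))
      (low⇒sparse y y-low) B≤b
      where
      t : ℕ
      t = nbrsIn inX∖B y

  C≤g : ⟦ # inC ⟧ ≤ g
  C≤g = k*12<g⇒k≤g ⟦ # inC ⟧ g {{nonNegative (⟦⟧-nonNeg (# inC))}} few-C

  size-lower : (1ℚ - α - γ) * ⟦ n ⟧ ≤ ⟦ ∣ A₁ ∣ ⟧
  size-lower = begin
    (1ℚ - α - γ) * n̂   ≡⟨ solve 3 (λ a c n → (con 1ℚ :- a :- c) :* n := (con 1ℚ :- a) :* n :- c :* n) refl α γ n̂ ⟩
    (1ℚ - α) * n̂ - g   ≡⟨ cong (_- g) m̂≡ ⟨
    m̂ - g              ≤⟨ m≤A+B⇒m-g≤A m̂ ⟦ # inA₁ ⟧ ⟦ # inB ⟧ g m̂≤A₁+B B≤g ⟩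
    ⟦ # inA₁ ⟧          ≡⟨ cong ⟦_⟧ ∣A₁∣≡ ⟨
    ⟦ ∣ A₁ ∣ ⟧          ∎
    where
    m̂≤A₁+B : m̂ ≤ ⟦ # inA₁ ⟧ + ⟦ # inB ⟧
    m̂≤A₁+B = subst (m̂ ≤_) (⟦⟧-homo-+ (# inA₁) (# inB))
      (⟦⟧-mono-≤ (subst (# inX ℕ.≤_) (sym #inA₁+#inB≡#inX+#inC) (ℕP.m≤m+n (# inX) (# inC))))

  size-upper : ⟦ ∣ A₁ ∣ ⟧ ≤ (1ℚ - α + γ) * ⟦ n ⟧
  size-upper = begin
    ⟦ ∣ A₁ ∣ ⟧               ≡⟨ cong ⟦_⟧ ∣A₁∣≡ ⟩
    ⟦ # inA₁ ⟧               ≤⟨ ⟦⟧-mono-≤ (subst (# inA₁ ℕ.≤_) #inA₁+#inB≡#inX+#inC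
                                                (ℕP.m≤m+n (# inA₁) (# inB))) ⟩
    ⟦ # inX ℕ.+ # inC ⟧      ≡⟨ ⟦⟧-homo-+ (# inX) (# inC) ⟩
    m̂ + ⟦ # inC ⟧            ≤⟨ +-monoʳ-≤ m̂ C≤g ⟩
    m̂ + g                    ≡⟨ cong (_+ g) m̂≡ ⟩
    (1ℚ - α) * n̂ + g         ≡⟨ solve 3 (λ a c n → (con 1ℚ :- a) :* n :+ c :* n := (con 1ℚ :- a :+ c) :* n) refl α γ n̂ ⟩
    (1ℚ - α + γ) * n̂         ∎

  ∈A₁⇒T : ∀ x → x ∈ A₁ → T (inA₁ x)
  ∈A₁⇒T x x∈A₁ = Equivalence.from T-≡ (trans (sym (lookup∘tabulate inA₁ x)) ([]=⇒lookup x∈A₁))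

  ∈∁A₁⇒T : ∀ x → x ∈ ∁ A₁ → T (not (inA₁ x))
  ∈∁A₁⇒T x x∈∁A₁ = Equivalence.from T-≡
    (trans (sym (trans (lookup-map x not A₁) (cong not (lookup∘tabulate inA₁ x)))) ([]=⇒lookup x∈∁A₁))

  few-nonNbrs-outside : ∀ x → x ∈ A₁ → ⟦ ∣ ∁ A₁ ∩ ∁ (N G x) ∣ ⟧ ≤ ⟦ 4 ⟧ * β * ⟦ n ⟧
  few-nonNbrs-outside x x∈A₁ = subst₂ _≤_ (cong ⟦_⟧ (sym (∣∁A₁∖N∣≡ x))) (sym (*-assoc ⟦ 4 ⟧ β n̂))
    (by-cases (Equivalence.to T-∨ (∈A₁⇒T x x∈A₁)))
    where
    Z : ℕ
    Z = nonNbrsIn (not ∘ inA₁) x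
    by-cases : T (inX∖B x) ⊎ T (inC x) → ⟦ Z ⟧ ≤ ⟦ 4 ⟧ * b
    by-cases (inj₁ x∈X∖B) = Z≤w+B⇒Z≤4b ⟦ Z ⟧ ⟦ nbrsIn inX x ⟧ ⟦ # inB ⟧ b
      (subst (⟦ Z ⟧ ≤_) (⟦⟧-homo-+ (nbrsIn inX x) (# inB))
             (⟦⟧-mono-≤ (nonNbrsOutsideA₁≤nbrsInX+#inB mindegℕ x)))
      (¬bad⇒sparse x (proj₂ (Equivalence.to T-∧ x∈X∖B))) B≤b
    by-cases (inj₂ x∈C) = Z≤w+B⇒Z≤4b ⟦ Z ⟧ ⟦ nbrsIn inX∖B x ⟧ ⟦ # inB ⟧ b
      (subst (⟦ Z ⟧ ≤_) (⟦⟧-homo-+ (nbrsIn inX∖B x) (# inB))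
             (⟦⟧-mono-≤ (nonNbrsOutsideA₁≤nbrsInX∖B+#inB mindegℕ x)))
      (≤-trans (<⇒≤ (low⇒sparse x (proj₂ (Equivalence.to T-∧ x∈C))))
               (p≤c*p ⟦ 3 ⟧ b (1≤⟦1+k⟧ 2)))
      B≤b

  many-nbrs-inside : ∀ x → x ∈ ∁ A₁ → β * ⟦ n ⟧ ≤ ⟦ ∣ N G x ∩ A₁ ∣ ⟧
  many-nbrs-inside x x∉A₁ = subst (b ≤_) (cong ⟦_⟧ (sym (∣N∩A₁∣≡ x))) (by-cases (∉A₁-cases x (∈∁A₁⇒T x x∉A₁)))
    where
    K : ℕ
    K = nbrsIn inA₁ x
    by-cases : T (inB x) ⊎ T (not (inX x) ∧ not (low x)) → b ≤ ⟦ K ⟧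
    by-cases (inj₁ x∈B) = 3b<K+B⇒b≤K ⟦ K ⟧ ⟦ # inB ⟧ b
      (<-≤-trans (bad⇒dense x (proj₂ (Equivalence.to T-∧ x∈B)))
                 (subst (⟦ nbrsIn inX x ⟧ ≤_) (⟦⟧-homo-+ K (# inB)) (⟦⟧-mono-≤ (nbrsInX≤nbrsInA₁+#inB x))))
      B≤b
    by-cases (inj₂ x∉C) = ≤-trans (¬low⇒dense x (proj₂ (Equivalence.to T-∧ x∉C))) (⟦⟧-mono-≤ (nbrsInX∖B≤nbrsInA₁ x))

  few-nonEdges-across : ⟦ nonEdgesBetween G A₁ (∁ A₁) ⟧ ≤ γ * ⟦ n ⟧ * ⟦ n ⟧
  few-nonEdges-across = subst (_≤ g * n̂) (cong ⟦_⟧ (sym nonEdgesBetween≡#²crossNonEdgeA₁))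
    (N≤S+n[B+C]⇒N≤gn ⟦ #² crossNonEdgeA₁ ⟧ ⟦ #² edgeInX ⟧ n̂ ⟦ # inB ⟧ ⟦ # inC ⟧ g b
      (subst (⟦ #² crossNonEdgeA₁ ⟧ ≤_) homo
        (⟦⟧-mono-≤ (ℕP.≤-trans crossNonEdgesA₁≤crossNonEdges+n*#inB+n*#inC
                                (ℕP.+-monoˡ-≤ _ (crossNonEdges≤degreeSum mindegℕ)))))
      degreeSum<2g² few-B few-C 8g≤b 5b≤n̂)
    where
    homo : ⟦ #² edgeInX ℕ.+ (n ℕ.* # inB ℕ.+ n ℕ.* # inC) ⟧ ≡ ⟦ #² edgeInX ⟧ + (n̂ * ⟦ # inB ⟧ + n̂ * ⟦ # inC ⟧)
    homo = trans (⟦⟧-homo-+ (#² edgeInX) _) (cong (⟦ #² edgeInX ⟧ +_)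
             (trans (⟦⟧-homo-+ (n ℕ.* # inB) (n ℕ.* # inC)) (cong₂ _+_ (⟦⟧-homo-* n (# inB)) (⟦⟧-homo-* n (# inC)))))

  stablePartition : Σ (Subset n) (StablePartition α γ β G)
  stablePartition = A₁ , (size-lower , size-upper) , few-nonNbrs-outside , many-nbrs-inside , few-nonEdges-across

lemma4p1 : (α γ β : ℚ) → 0ℚ < α → α < 1ℚ → 0ℚ < γ → 0ℚ < β →
    ⟦ 8 ⟧ * γ < β → ⟦ 5 ⟧ * β < 1ℚ - α →
    (n : ℕ) (G : Graph n) → (∀ x → α * ⟦ n ⟧ ≤ ⟦ ∣ N G x ∣ ⟧) →
    (Σ (Subset n) λ A₁ →
        ((1ℚ - α - γ) * ⟦ n ⟧ ≤ ⟦ ∣ A₁ ∣ ⟧ × ⟦ ∣ A₁ ∣ ⟧ ≤ (1ℚ - α + γ) * ⟦ n ⟧)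
      × (∀ x → x ∈ A₁ → ⟦ ∣ ∁ A₁ ∩ ∁ (N G x) ∣ ⟧ ≤ ⟦ 4 ⟧ * β * ⟦ n ⟧)
      × (∀ x → x ∈ ∁ A₁ → β * ⟦ n ⟧ ≤ ⟦ ∣ N G x ∩ A₁ ∣ ⟧)
      × ⟦ nonEdgesBetween G A₁ (∁ A₁) ⟧ ≤ γ * ⟦ n ⟧ * ⟦ n ⟧)
    ⊎ (∀ (X : Subset n) → ⟦ ∣ X ∣ ⟧ ≡ (1ℚ - α) * ⟦ n ⟧ →
        γ * γ * ⟦ n ⟧ * ⟦ n ⟧ ≤ ⟦ edgesIn G X ⟧)
lemma4p1 α γ β _ _ 0<γ 0<β 8γ<β 5β<1-α n G mindeg = case anySubset? sparse? of λ where
    (yes (X , ∣X∣≡ , sparse)) → inj₁ (Stability.stablePartition α γ β 0<γ 0<β 8γ<β 5β<1-α G mindeg X ∣X∣≡ sparse)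
    (no no-sparse) → inj₂ λ X ∣X∣≡ →
      decidable-stable (γ * γ * ⟦ n ⟧ * ⟦ n ⟧ ≤? ⟦ edgesIn G X ⟧) (λ sparse → no-sparse (X , ∣X∣≡ , sparse))
  where
  sparse? : ∀ X → Dec (⟦ ∣ X ∣ ⟧ ≡ (1ℚ - α) * ⟦ n ⟧ × ¬ (γ * γ * ⟦ n ⟧ * ⟦ n ⟧ ≤ ⟦ edgesIn G X ⟧))
  sparse? X = (⟦ ∣ X ∣ ⟧ ≟ (1ℚ - α) * ⟦ n ⟧) ×-dec ¬? (γ * γ * ⟦ n ⟧ * ⟦ n ⟧ ≤? ⟦ edgesIn G X ⟧)
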